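{- Let $n\ge1$ and let $a_{ij}$ ($i=0,\dots,n$, $j=1,\dots,n$) be positive integers with $a_{0j}\le\dots\le a_{n-1,j}$ for every $j$; let $\mathcal{A}_i=\{b\in\mathbb{Z}^n:0\le b_j\le a_{ij}\}$ with $\mathcal{B}$, $t_b$, $\mathcal{G}$ as in the context. If $b\in\mathcal{G}$ and $t_{b,I}=0$ for some $I\in\{0,\dots,n\}$, then $\sum_{i=0}^It_{b,i}<I+1$.
   Context: $\Delta_i=\mathrm{conv}(\mathcal{A}_i)$, $\Delta=\sum_i\Delta_i$. Fix $v\in\mathbb{R}^n$ with all $v_j<0$ and sufficiently small reals $\lambda_0>\dots>\lambda_n\ge0$; the lifting $\omega_i(x)=\lambda_i\langle v,x\rangle$ on $\mathcal{A}_i$ induces a coherent mixed subdivision $S(\rho)$ of $\Delta$ with cells $D=D_0+\dots+D_n$. Fix $\delta\in\mathbb{R}^n$ with all coordinates negative and sufficiently small (generic), $\mathcal{B}=(\Delta+\delta)\cap\mathbb{Z}^n$. For $b$ in a translated $n$-cell $D+\delta$, $t_{b,i}=\dim D_i$ (so $\sum_it_{b,i}=n$). $\mathcal{G}=\{b\in\mathcal{B}:\sum_{i=0}^It_{b,i}\le I+1\ \forall I<n\}$. -}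

module Defs where

open import Data.Nat using (ℕ; zero; suc; _+_; _≤_; _<_)
open import Data.Fin using (Fin; zero; suc; toℕ; _≟_)
open import Data.Integer as ℤ using (ℤ; +_)
open import Data.Product using (_×_)
open import Relation.Nullary using (does)
open import Data.Bool using (if_then_else_)

sumBelow : ∀ {m} → (Fin m → ℕ) → ℕ → ℕ
sumBelow {zero}  f c       = 0
sumBelow {suc m} f zero    = 0
sumBelow {suc m} f (suc c) = f zero + sumBelow (λ k → f (suc k)) c

count : ∀ {m k} → (Fin m → Fin k) → Fin k → ℕ
count {zero}  σ i = 0
count {suc m} σ i = (if does (σ zero ≟ i) then 1 else 0) + count (λ j → σ (suc j)) i

-- a i j = a_{ij},  i ∈ {0,…,n} (Fin (suc n)),  j ∈ {1,…,n} (Fin n, shifted by one)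
Exponents : ℕ → Set
Exponents n = Fin (suc n) → Fin n → ℕ

Positive : ∀ {n} → Exponents n → Set
Positive {n} a = ∀ (i : Fin (suc n)) (j : Fin n) → 1 ≤ a i j

Monotone : ∀ {n} → Exponents n → Set
Monotone {n} a = ∀ (i i' : Fin (suc n)) (j : Fin n) →
  toℕ i ≤ toℕ i' → toℕ i' < n → a i j ≤ a i' j

-- Δ = Σ_i Δ_i is the box Π_j [0, A_j] with A_j = Σ_{i=0}^n a_{ij}.
side : ∀ {n} → Exponents n → Fin n → ℕ
side {n} a j = sumBelow (λ i → a i j) (suc n)

-- 𝓑 = (Δ + δ) ∩ ℤⁿ ; since δ has small negative generic coordinates,
-- b ∈ Δ + δ  ⇔  0 ≤ b_j and b_j < A_j for all j.
InB : ∀ {n} → Exponents n → (Fin n → ℤ) → Set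
InB {n} a b = ∀ (j : Fin n) → (+ 0 ℤ.≤ b j) × (b j ℤ.< + side a j)

-- The n-cells of the mixed subdivision S(ρ) induced by ω_i(x) = λ_i⟨v,x⟩
-- (v_j < 0, λ_0 > … > λ_n ≥ 0 small) are indexed by σ : Fin n → Fin (suc n)
-- (coordinate j is "free" in summand σ j): D(σ) = D_0 + … + D_n with
--   D_i = Π_j ( [0,a_{ij}] if σ j = i ; {a_{ij}} if i < σ j ; {0} if i > σ j ),
-- so D(σ) = Π_j [ Σ_{i<σ j} a_{ij} , Σ_{i≤σ j} a_{ij} ].
-- b ∈ D(σ) + δ (δ negative, small, generic) ⇔ for all j:
--   Σ_{i<σ j} a_{ij} ≤ b_j < Σ_{i≤σ j} a_{ij}.
InTranslatedCell : ∀ {n} → Exponents n → (Fin n → Fin (suc n)) → (Fin n → ℤ) → Set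
InTranslatedCell {n} a σ b = ∀ (j : Fin n) →
  (+ sumBelow (λ i → a i j) (toℕ (σ j)) ℤ.≤ b j) ×
  (b j ℤ.< + sumBelow (λ i → a i j) (suc (toℕ (σ j))))

-- t_{b,i} = dim D_i(σ) = #{ j : σ j = i }
tvec : ∀ {n} → (Fin n → Fin (suc n)) → Fin (suc n) → ℕ
tvec σ i = count σ i

partialT : ∀ {n} → (Fin n → Fin (suc n)) → ℕ → ℕ
partialT σ I = sumBelow (tvec σ) (suc I)

InG : ∀ {n} → Exponents n → (Fin n → Fin (suc n)) → (Fin n → ℤ) → Set
InG {n} a σ b = InB a b × (∀ (I : Fin n) → partialT σ (toℕ I) ≤ suc (toℕ I))

{-# OPTIONS --safe #-}
-- As t_{b,I} = 0, the partial sum of t_b up to I equals the one up to I − 1,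
-- which the defining inequalities of 𝓖 bound by I (for I = 0 it is empty).
module Submission where

open import Defs
open import Data.Nat using (ℕ; zero; suc; _+_; _≤_; _<_; z≤n)
open import Data.Nat.Properties using (+-identityʳ; +-assoc; n<1+n; module ≤-Reasoning)
open import Data.Fin using (Fin; toℕ; zero; suc)
open import Data.Integer using (ℤ)
open import Data.Product using (proj₂)
open import Relation.Binary.PropositionalEquality using (_≡_; refl; sym; trans; cong)

sumBelow-zero : ∀ {m} (f : Fin m → ℕ) → sumBelow f 0 ≡ 0
sumBelow-zero {zero}  f = refl
sumBelow-zero {suc m} f = refl

sumBelow-suc : ∀ {m} (f : Fin m → ℕ) (i : Fin m) →
  sumBelow f (suc (toℕ i)) ≡ sumBelow f (toℕ i) + f i
sumBelow-suc {suc m} f zero =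
  trans (cong (f zero +_) (sumBelow-zero (λ k → f (suc k)))) (+-identityʳ (f zero))
sumBelow-suc {suc m} f (suc i) =
  trans (cong (f zero +_) (sumBelow-suc (λ k → f (suc k)) i))
        (sym (+-assoc (f zero) _ (f (suc i))))

sumBelow-≤-toℕ : ∀ {n} (f : Fin (suc n) → ℕ) →
  (∀ (J : Fin n) → sumBelow f (suc (toℕ J)) ≤ suc (toℕ J)) →
  ∀ (I : Fin (suc n)) → sumBelow f (toℕ I) ≤ toℕ I
sumBelow-≤-toℕ f bound zero    = z≤n
sumBelow-≤-toℕ f bound (suc J) = bound J

lemma3p12 : (n : ℕ) → 1 ≤ n → (a : Exponents n) → Positive a → Monotone a →
    (σ : Fin n → Fin (suc n)) → (b : Fin n → ℤ) →
    InTranslatedCell a σ b → InG a σ b →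
    (I : Fin (suc n)) → tvec σ I ≡ 0 →
    partialT σ (toℕ I) < suc (toℕ I)
lemma3p12 _ _ _ _ _ σ _ _ b∈𝓖 I tᵢ≡0 = begin-strict
  partialT σ (toℕ I)                     ≡⟨ sumBelow-suc (tvec σ) I ⟩
  sumBelow (tvec σ) (toℕ I) + tvec σ I   ≡⟨ cong (sumBelow (tvec σ) (toℕ I) +_) tᵢ≡0 ⟩
  sumBelow (tvec σ) (toℕ I) + 0          ≡⟨ +-identityʳ _ ⟩
  sumBelow (tvec σ) (toℕ I)              ≤⟨ sumBelow-≤-toℕ (tvec σ) (proj₂ b∈𝓖) I ⟩
  toℕ I                                  <⟨ n<1+n (toℕ I) ⟩
  suc (toℕ I)                            ∎
  where open ≤-Reasoning
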